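{- The Lindenbaum algebra $\mathcal{F}^*_n/\!\sim$ of Kleene's $n$-ary logic is free in the class of DMF-algebras with $\{|p_i|: 1\le i\le n\}$ as a set of free generators: for every DMF-algebra $\mathcal{A}$ and every map $g:\{|p_i|\}\to A$ there is a unique DMF-homomorphism $\overline{g}:\mathcal{F}^*_n/\!\sim\ \to\mathcal{A}$ extending $g$.
   Context: A DMF-algebra is an algebra $(A,\wedge,\vee,\lnot,0,1,n)$ such that $(A,\wedge,\vee,0,1)$ is a bounded distributive lattice, $\lnot\lnot x=x$, $\lnot(x\wedge y)=\lnot x\vee\lnot y$, $x\wedge\lnot x\le y\vee\lnot y$, and $\lnot n=n$. $L^*_n$ is the propositional language with variables $p_1,\dots,p_n$, connectives $\lnot,\wedge,\vee$ and constants $0,1,n$; $\mathcal{F}^*_n$ is its absolutely free algebra of formulas. Let $K=\{0,n,1\}$ and, for a set $S$, $\mathcal{D}(S)$ the algebra of partial sets $\{(A,B):A,B\subseteq S, A\cap B=\emptyset\}$ with $(A,B)\sqcap(C,D)=(A\cap C,B\cup D)$, $(A,B)\sqcup(C,D)=(A\cup C,B\cap D)$, $-(A,B)=(B,A)$, $0=(\emptyset,S)$, $1=(S,\emptyset)$, $n=(\emptyset,\emptyset)$. The meaning $M:\mathcal{F}^*_n\to\mathcal{D}(K^n)$ is the homomorphism with $M(p_i)=(\{s\in K^n:s_i=1\},\{s\in K^n:s_i=0\})$ (and $\wedge,\vee,\lnot,0,1,n$ sent to $\sqcap,\sqcup,-,0,1,n$). Set $\alpha\sim\beta$ iff $M(\alpha)=M(\beta)$;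 $\mathcal{F}^*_n/\!\sim$ is the quotient algebra and $|\alpha|$ the class of $\alpha$. -}

module Defs where

open import Level using (Level; _⊔_; suc)
open import Data.Bool using (Bool; true; false; _∧_; _∨_; not)
open import Data.Nat using (ℕ)
open import Data.Fin using (Fin)
open import Data.Vec using (Vec; lookup)
open import Data.Product using (_×_)
open import Relation.Binary.Core using (Rel)
open import Relation.Binary.PropositionalEquality using (_≡_; refl)
open import Algebra.Core using (Op₁; Op₂)
import Algebra.Definitions as AD
import Algebra.Lattice.Structures as LS

-- DMF-algebras (De Morgan–Kleene algebras with a fixed point n of ¬),
-- over an arbitrary setoid equality _≈_.

record IsDMFAlgebra {a ℓ} {A : Set a} (_≈_ : Rel A ℓ)
                    (_⊓_ _⊔'_ : Op₂ A) (¬_ : Op₁ A) (𝟘 𝟙 𝕟 : A) : Set (a ⊔ ℓ) where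
  open AD _≈_
  field
    isDistributiveLattice : LS.IsDistributiveLattice _≈_ _⊔'_ _⊓_
    ¬-cong     : Congruent₁ ¬_
    ∧-identity : Identity 𝟙 _⊓_
    ∨-identity : Identity 𝟘 _⊔'_
    ¬-involutive : ∀ x → (¬ (¬ x)) ≈ x
    deMorgan   : ∀ x y → (¬ (x ⊓ y)) ≈ ((¬ x) ⊔' (¬ y))
    kleene     : ∀ x y → ((x ⊓ (¬ x)) ⊓ (y ⊔' (¬ y))) ≈ (x ⊓ (¬ x))
                 -- i.e. x ∧ ¬x ≤ y ∨ ¬y, with a ≤ b :⇔ a ∧ b = a
    ¬n≈n       : (¬ 𝕟) ≈ 𝕟

record DMFAlgebra (c ℓ : Level) : Set (suc (c ⊔ ℓ)) where
  infix  4 _≈_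
  field
    Carrier : Set c
    _≈_     : Rel Carrier ℓ
    _∧ₐ_    : Op₂ Carrier
    _∨ₐ_    : Op₂ Carrier
    ¬ₐ      : Op₁ Carrier
    0ₐ 1ₐ nₐ : Carrier
    isDMFAlgebra : IsDMFAlgebra _≈_ _∧ₐ_ _∨ₐ_ ¬ₐ 0ₐ 1ₐ nₐ
  open IsDMFAlgebra isDMFAlgebra public

data Formula (n : ℕ) : Set where
  var  : Fin n → Formula n
  ¬f   : Formula n → Formula n
  _∧f_ : Formula n → Formula n → Formula n
  _∨f_ : Formula n → Formula n → Formula n
  0f 1f nf : Formula n

data K : Set where
  k0 kn k1 : K

isOne : K → Bool
isOne k1 = true
isOne _  = false

isZero : K → Bool
isZero k0 = true
isZero _  = false

-- A partial set (A , B) over S: A, B ⊆ S (as decidable subsets S → Bool)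
-- with A ∩ B = ∅.
record PSet (S : Set) : Set where
  constructor ⟨_,_∣_⟩
  field
    pos  : S → Bool
    neg  : S → Bool
    disj : ∀ s → pos s ∧ neg s ≡ false
open PSet public

private
  meetDisj : ∀ a b c d → a ∧ b ≡ false → c ∧ d ≡ false → (a ∧ c) ∧ (b ∨ d) ≡ false
  meetDisj false b c d _ _ = refl
  meetDisj true b false d _ _ = refl
  meetDisj true false true false _ _ = refl
  meetDisj true true true d () _
  meetDisj true false true true _ ()

  joinDisj : ∀ a b c d → a ∧ b ≡ false → c ∧ d ≡ false → (a ∨ c) ∧ (b ∧ d) ≡ false
  joinDisj false b false d _ _ = refl
  joinDisj true false c d _ _ = refl
  joinDisj true true c d () _
  joinDisj false false true d _ _ = refl
  joinDisj false true true false _ _ = refl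
  joinDisj false true true true _ ()

  swapDisj : ∀ a b → a ∧ b ≡ false → b ∧ a ≡ false
  swapDisj false false _ = refl
  swapDisj false true _ = refl
  swapDisj true false _ = refl
  swapDisj true true ()

_⊓ᴰ_ : ∀ {S} → PSet S → PSet S → PSet S
⟨ A , B ∣ p ⟩ ⊓ᴰ ⟨ C , D ∣ q ⟩ =
  ⟨ (λ s → A s ∧ C s) , (λ s → B s ∨ D s) ∣ (λ s → meetDisj (A s) (B s) (C s) (D s) (p s) (q s)) ⟩

_⊔ᴰ_ : ∀ {S} → PSet S → PSet S → PSet S
⟨ A , B ∣ p ⟩ ⊔ᴰ ⟨ C , D ∣ q ⟩ =
  ⟨ (λ s → A s ∨ C s) , (λ s → B s ∧ D s) ∣ (λ s → joinDisj (A s) (B s) (C s) (D s) (p s) (q s)) ⟩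

-ᴰ_ : ∀ {S} → PSet S → PSet S
-ᴰ ⟨ A , B ∣ p ⟩ = ⟨ B , A ∣ (λ s → swapDisj (A s) (B s) (p s)) ⟩

0ᴰ 1ᴰ nᴰ : ∀ {S} → PSet S
0ᴰ = ⟨ (λ _ → false) , (λ _ → true) ∣ (λ _ → refl) ⟩
1ᴰ = ⟨ (λ _ → true) , (λ _ → false) ∣ (λ _ → refl) ⟩
nᴰ = ⟨ (λ _ → false) , (λ _ → false) ∣ (λ _ → refl) ⟩

_≐_ : ∀ {S} → PSet S → PSet S → Set
X ≐ Y = ∀ s → (pos X s ≡ pos Y s) × (neg X s ≡ neg Y s)

M : ∀ {n} → Formula n → PSet (Vec K n)
M (var i) = ⟨ (λ s → isOne (lookup s i)) , (λ s → isZero (lookup s i)) ∣ (λ s → d (lookup s i)) ⟩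
  where
    d : ∀ k → isOne k ∧ isZero k ≡ false
    d k0 = refl
    d kn = refl
    d k1 = refl
M (¬f α)    = -ᴰ (M α)
M (α ∧f β)  = M α ⊓ᴰ M β
M (α ∨f β)  = M α ⊔ᴰ M β
M 0f = 0ᴰ
M 1f = 1ᴰ
M nf = nᴰ

-- α ∼ β iff M(α) = M(β); the Lindenbaum algebra F*_n/∼ is represented
-- as the setoid (Formula n , _∼_) with the formula constructors as operations.
_∼_ : ∀ {n} → Formula n → Formula n → Set
α ∼ β = M α ≐ M β

-- DMF-homomorphisms F*_n/∼ → A, given by a map on representatives
-- that is well defined on ∼-classes and preserves all operations.

record IsDMFHom {c ℓ n} (𝒜 : DMFAlgebra c ℓ) (h : Formula n → DMFAlgebra.Carrier 𝒜) : Set (c ⊔ ℓ) where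
  open DMFAlgebra 𝒜
  field
    well-defined : ∀ {α β} → α ∼ β → h α ≈ h β
    hom-∧ : ∀ α β → h (α ∧f β) ≈ (h α ∧ₐ h β)
    hom-∨ : ∀ α β → h (α ∨f β) ≈ (h α ∨ₐ h β)
    hom-¬ : ∀ α → h (¬f α) ≈ ¬ₐ (h α)
    hom-0 : h 0f ≈ 0ₐ
    hom-1 : h 1f ≈ 1ₐ
    hom-n : h nf ≈ nₐ

module Submission where

-- Everything is organised around the three-element DMF-algebra 𝕂 = {0 < n < 1}.
-- The meaning M(α) of a formula is exactly the table of its three-valued truth
-- values, so α ∼ β iff α and β take the same value in 𝕂 at every point
-- t : Fin n → K.  Hence F*_n/∼ inherits every DMF-law from 𝕂, and two distinct
-- variables are told apart by a suitable point.
--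
-- For the universal property, a map g into a DMF-algebra 𝒜 extends to formulas
-- by evaluation; extensions are unique by induction.  The real content is that
-- evaluation respects ∼, i.e. a completeness theorem: if P ≤ Q at every point of
-- 𝕂 then ⟦P⟧ ≤ ⟦Q⟧ in 𝒜.  Put P in negation normal form and disjunctive normal
-- form (valid in every DMF-algebra); it then suffices to bound one clause C.
-- A consistent classical clause is true at its own point, which forces ⟦C⟧ ≤ ⟦Q⟧
-- atom by atom.  Otherwise ⟦C⟧ ≤ n, and the Kleene law n ≤ x ∨ ¬x splits C on
-- each variable into clauses that mention every variable; such a clause is
-- non-false at its point, which again forces ⟦C⟧ ≤ ⟦Q⟧ atom by atom.

open import Defs
open import Level using (Level; 0ℓ)
open import Function using (id)
open import Data.Nat using (ℕ)
open import Data.Fin using (Fin; _≟_)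
open import Data.Fin.Properties using (any?)
open import Data.Bool using (Bool; true; false; not; T; _∧_; _∨_; if_then_else_)
open import Data.Bool.Properties using () renaming (_≟_ to _≟B_)
open import Data.Empty using (⊥-elim)
open import Data.Product using (Σ; _×_; _,_; proj₁; proj₂; ∃)
open import Data.Sum using (_⊎_; inj₁; inj₂; fromInj₂; swap) renaming (map to ⊎-map)
open import Data.List using (List; []; _∷_; _++_; map; concatMap; allFin; [_])
open import Data.List.Relation.Unary.Any using (here; there)
open import Data.List.Membership.Propositional using (_∈_; _∉_)
open import Data.List.Membership.Propositional.Properties using (∈-allFin)
import Data.List.Membership.DecPropositional as DecMembership
open import Data.Vec using (Vec; lookup; tabulate)
open import Data.Vec.Properties using (lookup∘tabulate)
open import Relation.Nullary using (Dec; yes; no; ¬_)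
open import Relation.Nullary.Decidable
  using (True; isYes; toWitness; fromWitness; map′; _×-dec_; _⊎-dec_; _→-dec_)
open import Relation.Binary.Definitions using (DecidableEquality)
open import Relation.Binary.PropositionalEquality
  using (_≡_; _≢_; refl; sym; trans; cong; cong₂; subst; module ≡-Reasoning)
open import Algebra.Lattice.Bundles using (Lattice)
import Algebra.Lattice.Properties.Lattice as LatticeProperties
open import Algebra.Lattice.Structures using (IsDistributiveLattice)
open import Relation.Binary.Lattice.Bundles using () renaming (Lattice to OrderLattice)
import Relation.Binary.Reasoning.Setoid as SetoidReasoning

-- The three-element Kleene chain 0 < n < 1

negK : K → K
negK k0 = k1
negK kn = kn
negK k1 = k0

minK : K → K → K
minK k0 _  = k0
minK kn k0 = k0
minK kn _  = kn
minK k1 y  = y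

maxK : K → K → K
maxK k0 y  = y
maxK kn k1 = k1
maxK kn _  = kn
maxK k1 _  = k1

_≟K_ : DecidableEquality K
k0 ≟K k0 = yes refl
k0 ≟K kn = no λ ()
k0 ≟K k1 = no λ ()
kn ≟K k0 = no λ ()
kn ≟K kn = yes refl
kn ≟K k1 = no λ ()
k1 ≟K k0 = no λ ()
k1 ≟K kn = no λ ()
k1 ≟K k1 = yes refl

-- K is finite, so a decidable property of all its elements can be checked by
-- running the decision procedure; the identities of 𝕂 are proved this way.
allK? : {P : K → Set} → (∀ k → Dec (P k)) → Dec (∀ k → P k)
allK? P? with P? k0 | P? kn | P? k1
... | yes p₀ | yes pₙ | yes p₁ = yes λ { k0 → p₀ ; kn → pₙ ; k1 → p₁ }
... | no ¬p₀ | _      | _      = no λ all → ¬p₀ (all k0)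
... | yes _  | no ¬pₙ | _      = no λ all → ¬pₙ (all kn)
... | yes _  | yes _  | no ¬p₁ = no λ all → ¬p₁ (all k1)

decide₁ : {P : K → Set} (P? : ∀ a → Dec (P a)) → {True (allK? P?)} → ∀ a → P a
decide₁ P? {ok} = toWitness ok

decide₂ : {P : K → K → Set} (P? : ∀ a b → Dec (P a b)) →
          {True (allK? λ a → allK? λ b → P? a b)} → ∀ a b → P a b
decide₂ P? {ok} = toWitness ok

decide₃ : {P : K → K → K → Set} (P? : ∀ a b c → Dec (P a b c)) →
          {True (allK? λ a → allK? λ b → allK? λ c → P? a b c)} → ∀ a b c → P a b c
decide₃ P? {ok} = toWitness ok

𝕂-isDMF : IsDMFAlgebra _≡_ minK maxK negK k0 k1 kn
𝕂-isDMF = record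
  { isDistributiveLattice = record
    { isLattice = record
      { isEquivalence = record { refl = refl ; sym = sym ; trans = trans }
      ; ∨-comm  = decide₂ λ x y → maxK x y ≟K maxK y x
      ; ∨-assoc = decide₃ λ x y z → maxK (maxK x y) z ≟K maxK x (maxK y z)
      ; ∨-cong  = cong₂ maxK
      ; ∧-comm  = decide₂ λ x y → minK x y ≟K minK y x
      ; ∧-assoc = decide₃ λ x y z → minK (minK x y) z ≟K minK x (minK y z)
      ; ∧-cong  = cong₂ minK
      ; absorptive = (decide₂ λ x y → maxK x (minK x y) ≟K x)
                   , (decide₂ λ x y → minK x (maxK x y) ≟K x)
      }
    ; ∨-distrib-∧ = (decide₃ λ x y z → maxK x (minK y z) ≟K minK (maxK x y) (maxK x z))
                  , (decide₃ λ x y z → maxK (minK y z) x ≟K minK (maxK y x) (maxK z x))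
    ; ∧-distrib-∨ = (decide₃ λ x y z → minK x (maxK y z) ≟K maxK (minK x y) (minK x z))
                  , (decide₃ λ x y z → minK (maxK y z) x ≟K maxK (minK y x) (minK z x))
    }
  ; ¬-cong       = cong negK
  ; ∧-identity   = (decide₁ λ x → minK k1 x ≟K x) , (decide₁ λ x → minK x k1 ≟K x)
  ; ∨-identity   = (decide₁ λ x → maxK k0 x ≟K x) , (decide₁ λ x → maxK x k0 ≟K x)
  ; ¬-involutive = decide₁ λ x → negK (negK x) ≟K x
  ; deMorgan     = decide₂ λ x y → negK (minK x y) ≟K maxK (negK x) (negK y)
  ; kleene       = decide₂ λ x y → minK (minK x (negK x)) (maxK y (negK y)) ≟K minK x (negK x)
  ; ¬n≈n         = refl
  }

𝕂 : DMFAlgebra 0ℓ 0ℓ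
𝕂 = record { isDMFAlgebra = 𝕂-isDMF }

module DMFProperties {c ℓ} (𝒜 : DMFAlgebra c ℓ) where
  open DMFAlgebra 𝒜 public
  open IsDistributiveLattice isDistributiveLattice public
    renaming (refl to ≈-refl; sym to ≈-sym; trans to ≈-trans)

  lattice : Lattice c ℓ
  lattice = record { isLattice = isLattice }

  open Lattice lattice public using (setoid)
  open LatticeProperties lattice using (∧-idem; ∨-idem; ∨-∧-orderTheoreticLattice)
  open SetoidReasoning setoid

  -- the lattice order x ≤ y :⇔ x ≈ x ∧ y, with its meet/join characterisation
  open OrderLattice ∨-∧-orderTheoreticLattice public
    using (_≤_; x∧y≤x; x∧y≤y; ∧-greatest; x≤x∨y; y≤x∨y; ∨-least)
    renaming (refl to ≤-refl; trans to ≤-trans; antisym to ≤-antisym; reflexive to ≤-reflexive)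

  ≤-1 : ∀ x → x ≤ 1ₐ
  ≤-1 x = ≈-sym (proj₂ ∧-identity x)

  0-≤ : ∀ x → 0ₐ ≤ x
  0-≤ x = ≈-sym (≈-trans (∧-congˡ (≈-sym (proj₁ ∨-identity x))) (∧-absorbs-∨ 0ₐ x))

  ∧-zeroʳ : ∀ x → x ∧ₐ 0ₐ ≈ 0ₐ
  ∧-zeroʳ x = ≈-trans (∧-comm x 0ₐ) (≈-sym (0-≤ x))

  ∨-oneʳ : ∀ x → x ∨ₐ 1ₐ ≈ 1ₐ
  ∨-oneʳ x = begin
    x ∨ₐ 1ₐ           ≈⟨ ∨-comm x 1ₐ ⟩
    1ₐ ∨ₐ x           ≈⟨ ∨-congˡ (≈-sym (proj₁ ∧-identity x)) ⟩
    1ₐ ∨ₐ (1ₐ ∧ₐ x)   ≈⟨ ∨-absorbs-∧ 1ₐ x ⟩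
    1ₐ                ∎

  ¬-∨ : ∀ x y → ¬ₐ (x ∨ₐ y) ≈ ¬ₐ x ∧ₐ ¬ₐ y
  ¬-∨ x y = begin
    ¬ₐ (x ∨ₐ y)                   ≈⟨ ¬-cong (∨-cong (¬-involutive x) (¬-involutive y)) ⟨
    ¬ₐ (¬ₐ (¬ₐ x) ∨ₐ ¬ₐ (¬ₐ y))   ≈⟨ ¬-cong (≈-sym (deMorgan (¬ₐ x) (¬ₐ y))) ⟩
    ¬ₐ (¬ₐ (¬ₐ x ∧ₐ ¬ₐ y))        ≈⟨ ¬-involutive _ ⟩
    ¬ₐ x ∧ₐ ¬ₐ y                  ∎

  ¬-0 : ¬ₐ 0ₐ ≈ 1ₐ
  ¬-0 = begin
    ¬ₐ 0ₐ                 ≈⟨ ¬-cong (0-≤ (¬ₐ 1ₐ)) ⟩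
    ¬ₐ (0ₐ ∧ₐ ¬ₐ 1ₐ)      ≈⟨ deMorgan 0ₐ (¬ₐ 1ₐ) ⟩
    ¬ₐ 0ₐ ∨ₐ ¬ₐ (¬ₐ 1ₐ)   ≈⟨ ∨-congˡ (¬-involutive 1ₐ) ⟩
    ¬ₐ 0ₐ ∨ₐ 1ₐ           ≈⟨ ∨-oneʳ (¬ₐ 0ₐ) ⟩
    1ₐ                    ∎

  ¬-1 : ¬ₐ 1ₐ ≈ 0ₐ
  ¬-1 = ≈-trans (¬-cong (≈-sym ¬-0)) (¬-involutive 0ₐ)

  n≤x∨¬x : ∀ x → nₐ ≤ x ∨ₐ ¬ₐ x
  n≤x∨¬x x = ≤-trans (≤-reflexive n≈n∧¬n) (≈-sym (kleene nₐ x))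
    where
      n≈n∧¬n : nₐ ≈ nₐ ∧ₐ ¬ₐ nₐ
      n≈n∧¬n = ≈-trans (≈-sym (∧-idem nₐ)) (∧-congˡ (≈-sym ¬n≈n))

  x∧¬x≤n : ∀ x → x ∧ₐ ¬ₐ x ≤ nₐ
  x∧¬x≤n x = ≤-trans (≈-sym (kleene x nₐ)) (≤-reflexive (≈-trans (∨-congˡ ¬n≈n) (∨-idem nₐ)))

  pol : Bool → Carrier → Carrier
  pol true  x = x
  pol false x = ¬ₐ x

  pol-not : ∀ b x → pol (not b) x ≈ pol b (¬ₐ x)
  pol-not true  x = ≈-refl
  pol-not false x = ≈-sym (¬-involutive x)

-- Syntax: negation normal forms and disjunctive normal forms

-- literals p_j (sign true), ¬p_j (sign false), and the constant n
data Atom (n : ℕ) : Set where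
  lit    : Bool → Fin n → Atom n
  nconst : Atom n

_≟ᵃ_ : ∀ {n} → DecidableEquality (Atom n)
lit b i ≟ᵃ lit b′ j = map′ (λ (b≡b′ , i≡j) → cong₂ lit b≡b′ i≡j) (λ { refl → refl , refl })
                           ((b ≟B b′) ×-dec (i ≟ j))
lit _ _ ≟ᵃ nconst   = no λ ()
nconst  ≟ᵃ lit _ _  = no λ ()
nconst  ≟ᵃ nconst   = yes refl

-- lattice terms over atoms: formulas with negation pushed to the variables
data LTerm (n : ℕ) : Set where
  atom      : Atom n → LTerm n
  _∧ᴸ_ _∨ᴸ_ : LTerm n → LTerm n → LTerm n
  ⊤ᴸ ⊥ᴸ     : LTerm n

-- nnf b α is a negation normal form of α (b = true) or of ¬α (b = false)
nnf : ∀ {n} → Bool → Formula n → LTerm n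
nnf b     (var i)  = atom (lit b i)
nnf b     (¬f α)   = nnf (not b) α
nnf true  (α ∧f β) = nnf true α ∧ᴸ nnf true β
nnf false (α ∧f β) = nnf false α ∨ᴸ nnf false β
nnf true  (α ∨f β) = nnf true α ∨ᴸ nnf true β
nnf false (α ∨f β) = nnf false α ∧ᴸ nnf false β
nnf true  0f       = ⊥ᴸ
nnf false 0f       = ⊤ᴸ
nnf true  1f       = ⊤ᴸ
nnf false 1f       = ⊥ᴸ
nnf b     nf       = atom nconst

-- a clause is a conjunction of atoms, a DNF a disjunction of clauses
Clause : ℕ → Set
Clause n = List (Atom n)

cross : ∀ {n} → List (Clause n) → List (Clause n) → List (Clause n)
cross Cs Ds = concatMap (λ C → map (C ++_) Ds) Cs

dnf : ∀ {n} → LTerm n → List (Clause n)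
dnf (atom a) = [ [ a ] ]
dnf (P ∧ᴸ Q) = cross (dnf P) (dnf Q)
dnf (P ∨ᴸ Q) = dnf P ++ dnf Q
dnf ⊤ᴸ       = [ [] ]
dnf ⊥ᴸ       = []

module Semantics {c ℓ} (𝒜 : DMFAlgebra c ℓ) {n : ℕ} (g : Fin n → DMFAlgebra.Carrier 𝒜) where
  open DMFProperties 𝒜
  open SetoidReasoning setoid

  ⟦_⟧ : Formula n → Carrier
  ⟦ var i ⟧  = g i
  ⟦ ¬f α ⟧   = ¬ₐ ⟦ α ⟧
  ⟦ α ∧f β ⟧ = ⟦ α ⟧ ∧ₐ ⟦ β ⟧
  ⟦ α ∨f β ⟧ = ⟦ α ⟧ ∨ₐ ⟦ β ⟧
  ⟦ 0f ⟧     = 0ₐ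
  ⟦ 1f ⟧     = 1ₐ
  ⟦ nf ⟧     = nₐ

  ⟦_⟧ᵃ : Atom n → Carrier
  ⟦ lit b j ⟧ᵃ = pol b (g j)
  ⟦ nconst ⟧ᵃ  = nₐ

  ⟦_⟧ᴸ : LTerm n → Carrier
  ⟦ atom a ⟧ᴸ = ⟦ a ⟧ᵃ
  ⟦ P ∧ᴸ Q ⟧ᴸ = ⟦ P ⟧ᴸ ∧ₐ ⟦ Q ⟧ᴸ
  ⟦ P ∨ᴸ Q ⟧ᴸ = ⟦ P ⟧ᴸ ∨ₐ ⟦ Q ⟧ᴸ
  ⟦ ⊤ᴸ ⟧ᴸ     = 1ₐ
  ⟦ ⊥ᴸ ⟧ᴸ     = 0ₐ

  ⟦_⟧ᶜ : Clause n → Carrier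
  ⟦ [] ⟧ᶜ    = 1ₐ
  ⟦ a ∷ C ⟧ᶜ = ⟦ a ⟧ᵃ ∧ₐ ⟦ C ⟧ᶜ

  ⟦_⟧ᵈ : List (Clause n) → Carrier
  ⟦ [] ⟧ᵈ     = 0ₐ
  ⟦ C ∷ Cs ⟧ᵈ = ⟦ C ⟧ᶜ ∨ₐ ⟦ Cs ⟧ᵈ

  extension-unique : ∀ h′ → IsDMFHom 𝒜 h′ → (∀ i → h′ (var i) ≈ g i) → ∀ α → h′ α ≈ ⟦ α ⟧
  extension-unique h′ h′-hom h′-vars = go
    where
      open IsDMFHom h′-hom
      go : ∀ α → h′ α ≈ ⟦ α ⟧
      go (var i)  = h′-vars i
      go (¬f α)   = ≈-trans (hom-¬ α) (¬-cong (go α))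
      go (α ∧f β) = ≈-trans (hom-∧ α β) (∧-cong (go α) (go β))
      go (α ∨f β) = ≈-trans (hom-∨ α β) (∨-cong (go α) (go β))
      go 0f       = hom-0
      go 1f       = hom-1
      go nf       = hom-n

  nnf-correct : ∀ b α → ⟦ nnf b α ⟧ᴸ ≈ pol b ⟦ α ⟧
  nnf-correct b     (var i)  = ≈-refl
  nnf-correct b     (¬f α)   = ≈-trans (nnf-correct (not b) α) (pol-not b ⟦ α ⟧)
  nnf-correct true  (α ∧f β) = ∧-cong (nnf-correct true α) (nnf-correct true β)
  nnf-correct false (α ∧f β) =
    ≈-trans (∨-cong (nnf-correct false α) (nnf-correct false β)) (≈-sym (deMorgan ⟦ α ⟧ ⟦ β ⟧))
  nnf-correct true  (α ∨f β) = ∨-cong (nnf-correct true α) (nnf-correct true β)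
  nnf-correct false (α ∨f β) =
    ≈-trans (∧-cong (nnf-correct false α) (nnf-correct false β)) (≈-sym (¬-∨ ⟦ α ⟧ ⟦ β ⟧))
  nnf-correct true  0f       = ≈-refl
  nnf-correct false 0f       = ≈-sym ¬-0
  nnf-correct true  1f       = ≈-refl
  nnf-correct false 1f       = ≈-sym ¬-1
  nnf-correct true  nf       = ≈-refl
  nnf-correct false nf       = ≈-sym ¬n≈n

  clause-++ : ∀ C D → ⟦ C ++ D ⟧ᶜ ≈ ⟦ C ⟧ᶜ ∧ₐ ⟦ D ⟧ᶜ
  clause-++ []      D = ≈-sym (proj₁ ∧-identity ⟦ D ⟧ᶜ)
  clause-++ (a ∷ C) D = ≈-trans (∧-congˡ (clause-++ C D)) (≈-sym (∧-assoc ⟦ a ⟧ᵃ ⟦ C ⟧ᶜ ⟦ D ⟧ᶜ))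

  dnf-++ : ∀ Cs Ds → ⟦ Cs ++ Ds ⟧ᵈ ≈ ⟦ Cs ⟧ᵈ ∨ₐ ⟦ Ds ⟧ᵈ
  dnf-++ []       Ds = ≈-sym (proj₁ ∨-identity ⟦ Ds ⟧ᵈ)
  dnf-++ (C ∷ Cs) Ds = ≈-trans (∨-congˡ (dnf-++ Cs Ds)) (≈-sym (∨-assoc ⟦ C ⟧ᶜ ⟦ Cs ⟧ᵈ ⟦ Ds ⟧ᵈ))

  dnf-prefix : ∀ C Ds → ⟦ map (C ++_) Ds ⟧ᵈ ≈ ⟦ C ⟧ᶜ ∧ₐ ⟦ Ds ⟧ᵈ
  dnf-prefix C []       = ≈-sym (∧-zeroʳ ⟦ C ⟧ᶜ)
  dnf-prefix C (D ∷ Ds) = begin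
    ⟦ C ++ D ⟧ᶜ ∨ₐ ⟦ map (C ++_) Ds ⟧ᵈ    ≈⟨ ∨-cong (clause-++ C D) (dnf-prefix C Ds) ⟩
    (⟦ C ⟧ᶜ ∧ₐ ⟦ D ⟧ᶜ) ∨ₐ (⟦ C ⟧ᶜ ∧ₐ ⟦ Ds ⟧ᵈ)  ≈⟨ ∧-distribˡ-∨ ⟦ C ⟧ᶜ ⟦ D ⟧ᶜ ⟦ Ds ⟧ᵈ ⟨
    ⟦ C ⟧ᶜ ∧ₐ (⟦ D ⟧ᶜ ∨ₐ ⟦ Ds ⟧ᵈ)          ∎

  dnf-cross : ∀ Cs Ds → ⟦ cross Cs Ds ⟧ᵈ ≈ ⟦ Cs ⟧ᵈ ∧ₐ ⟦ Ds ⟧ᵈ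
  dnf-cross []       Ds = 0-≤ ⟦ Ds ⟧ᵈ
  dnf-cross (C ∷ Cs) Ds = begin
    ⟦ map (C ++_) Ds ++ cross Cs Ds ⟧ᵈ         ≈⟨ dnf-++ (map (C ++_) Ds) (cross Cs Ds) ⟩
    ⟦ map (C ++_) Ds ⟧ᵈ ∨ₐ ⟦ cross Cs Ds ⟧ᵈ    ≈⟨ ∨-cong (dnf-prefix C Ds) (dnf-cross Cs Ds) ⟩
    (⟦ C ⟧ᶜ ∧ₐ ⟦ Ds ⟧ᵈ) ∨ₐ (⟦ Cs ⟧ᵈ ∧ₐ ⟦ Ds ⟧ᵈ) ≈⟨ ∧-distribʳ-∨ ⟦ Ds ⟧ᵈ ⟦ C ⟧ᶜ ⟦ Cs ⟧ᵈ ⟨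
    (⟦ C ⟧ᶜ ∨ₐ ⟦ Cs ⟧ᵈ) ∧ₐ ⟦ Ds ⟧ᵈ             ∎

  dnf-correct : ∀ P → ⟦ P ⟧ᴸ ≈ ⟦ dnf P ⟧ᵈ
  dnf-correct (atom a) = begin
    ⟦ a ⟧ᵃ                     ≈⟨ proj₂ ∧-identity ⟦ a ⟧ᵃ ⟨
    ⟦ a ⟧ᵃ ∧ₐ 1ₐ               ≈⟨ proj₂ ∨-identity _ ⟨
    (⟦ a ⟧ᵃ ∧ₐ 1ₐ) ∨ₐ 0ₐ       ∎
  dnf-correct (P ∧ᴸ Q) =
    ≈-trans (∧-cong (dnf-correct P) (dnf-correct Q)) (≈-sym (dnf-cross (dnf P) (dnf Q)))
  dnf-correct (P ∨ᴸ Q) =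
    ≈-trans (∨-cong (dnf-correct P) (dnf-correct Q)) (≈-sym (dnf-++ (dnf P) (dnf Q)))
  dnf-correct ⊤ᴸ       = ≈-sym (proj₂ ∨-identity 1ₐ)
  dnf-correct ⊥ᴸ       = ≈-refl

  clause-∈ : ∀ {a C} → a ∈ C → ⟦ C ⟧ᶜ ≤ ⟦ a ⟧ᵃ
  clause-∈ (here refl) = x∧y≤x _ _
  clause-∈ (there a∈C) = ≤-trans (x∧y≤y _ _) (clause-∈ a∈C)

  clause-greatest : ∀ {x} C → (∀ {a} → a ∈ C → x ≤ ⟦ a ⟧ᵃ) → x ≤ ⟦ C ⟧ᶜ
  clause-greatest []      _     = ≤-1 _
  clause-greatest (a ∷ C) below =
    ∧-greatest (below (here refl)) (clause-greatest C (λ m → below (there m)))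

  dnf-least : ∀ {x} Cs → (∀ {C} → C ∈ Cs → ⟦ C ⟧ᶜ ≤ x) → ⟦ Cs ⟧ᵈ ≤ x
  dnf-least []       _     = 0-≤ _
  dnf-least (C ∷ Cs) above = ∨-least (above (here refl)) (dnf-least Cs (λ m → above (there m)))

  dnf-clause-below : ∀ P {C} → C ∈ dnf P → ⟦ C ⟧ᶜ ≤ ⟦ P ⟧ᴸ
  dnf-clause-below P C∈ = ≤-trans (member C∈) (≤-reflexive (≈-sym (dnf-correct P)))
    where
      member : ∀ {C Cs} → C ∈ Cs → ⟦ C ⟧ᶜ ≤ ⟦ Cs ⟧ᵈ
      member (here refl) = x≤x∨y _ _
      member (there m)   = ≤-trans (member m) (y≤x∨y _ _)

module 𝕂≤ = DMFProperties 𝕂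
open 𝕂≤ using () renaming (_≤_ to _≤K_; ≤-trans to ≤K-trans; ≤-reflexive to ≤K-reflexive)

K⟦_⟧ : ∀ {n} → Formula n → (Fin n → K) → K
K⟦ α ⟧ t = Semantics.⟦_⟧ 𝕂 t α

K⟦_⟧ᵃ : ∀ {n} → Atom n → (Fin n → K) → K
K⟦ a ⟧ᵃ t = Semantics.⟦_⟧ᵃ 𝕂 t a

K⟦_⟧ᴸ : ∀ {n} → LTerm n → (Fin n → K) → K
K⟦ P ⟧ᴸ t = Semantics.⟦_⟧ᴸ 𝕂 t P

K⟦_⟧ᶜ : ∀ {n} → Clause n → (Fin n → K) → K
K⟦ C ⟧ᶜ t = Semantics.⟦_⟧ᶜ 𝕂 t C

K⟦⟧-cong : ∀ {n} {t t′ : Fin n → K} → (∀ i → t i ≡ t′ i) → ∀ α → K⟦ α ⟧ t ≡ K⟦ α ⟧ t′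
K⟦⟧-cong t≡t′ (var i)  = t≡t′ i
K⟦⟧-cong t≡t′ (¬f α)   = cong negK (K⟦⟧-cong t≡t′ α)
K⟦⟧-cong t≡t′ (α ∧f β) = cong₂ minK (K⟦⟧-cong t≡t′ α) (K⟦⟧-cong t≡t′ β)
K⟦⟧-cong t≡t′ (α ∨f β) = cong₂ maxK (K⟦⟧-cong t≡t′ α) (K⟦⟧-cong t≡t′ β)
K⟦⟧-cong t≡t′ 0f       = refl
K⟦⟧-cong t≡t′ 1f       = refl
K⟦⟧-cong t≡t′ nf       = refl

-- 𝕂 is a chain: anything below a join is below one of the joinands
≤K-max-split : ∀ v a b → v ≤K maxK a b → v ≤K a ⊎ v ≤K b
≤K-max-split = decide₃ λ v a b →
  (v ≟K minK v (maxK a b)) →-dec ((v ≟K minK v a) ⊎-dec (v ≟K minK v b))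

≤K-bottom : ∀ v → v ≤K k0 → v ≡ k0
≤K-bottom = decide₁ λ v → (v ≟K minK v k0) →-dec (v ≟K k0)

-- The Lindenbaum algebra F*_n/∼

-- the two components of a partial set record whether a value is 1 or 0
isOne-neg : ∀ a → isOne (negK a) ≡ isZero a
isOne-neg = decide₁ λ a → isOne (negK a) ≟B isZero a

isZero-neg : ∀ a → isZero (negK a) ≡ isOne a
isZero-neg = decide₁ λ a → isZero (negK a) ≟B isOne a

isOne-min : ∀ a b → isOne (minK a b) ≡ isOne a ∧ isOne b
isOne-min = decide₂ λ a b → isOne (minK a b) ≟B (isOne a ∧ isOne b)

isZero-min : ∀ a b → isZero (minK a b) ≡ isZero a ∨ isZero b
isZero-min = decide₂ λ a b → isZero (minK a b) ≟B (isZero a ∨ isZero b)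

isOne-max : ∀ a b → isOne (maxK a b) ≡ isOne a ∨ isOne b
isOne-max = decide₂ λ a b → isOne (maxK a b) ≟B (isOne a ∨ isOne b)

isZero-max : ∀ a b → isZero (maxK a b) ≡ isZero a ∧ isZero b
isZero-max = decide₂ λ a b → isZero (maxK a b) ≟B (isZero a ∧ isZero b)

isOne-isZero-injective : ∀ a b → isOne a ≡ isOne b → isZero a ≡ isZero b → a ≡ b
isOne-isZero-injective = decide₂ λ a b →
  (isOne a ≟B isOne b) →-dec ((isZero a ≟B isZero b) →-dec (a ≟K b))

M-eval : ∀ {n} (α : Formula n) (s : Vec K n) →
         (pos (M α) s ≡ isOne (K⟦ α ⟧ (lookup s))) × (neg (M α) s ≡ isZero (K⟦ α ⟧ (lookup s)))
M-eval (var i) s = refl , refl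
M-eval (¬f α) s with M-eval α s
... | p , q = trans q (sym (isOne-neg a)) , trans p (sym (isZero-neg a))
  where
    a : K
    a = K⟦ α ⟧ (lookup s)
M-eval (α ∧f β) s with M-eval α s | M-eval β s
... | p , q | p′ , q′ = trans (cong₂ _∧_ p p′) (sym (isOne-min a b))
                      , trans (cong₂ _∨_ q q′) (sym (isZero-min a b))
  where
    a b : K
    a = K⟦ α ⟧ (lookup s)
    b = K⟦ β ⟧ (lookup s)
M-eval (α ∨f β) s with M-eval α s | M-eval β s
... | p , q | p′ , q′ = trans (cong₂ _∨_ p p′) (sym (isOne-max a b))
                      , trans (cong₂ _∧_ q q′) (sym (isZero-max a b))
  where
    a b : K
    a = K⟦ α ⟧ (lookup s)
    b = K⟦ β ⟧ (lookup s)
M-eval 0f s = refl , refl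
M-eval 1f s = refl , refl
M-eval nf s = refl , refl

_≋_ : ∀ {n} → Formula n → Formula n → Set
α ≋ β = ∀ t → K⟦ α ⟧ t ≡ K⟦ β ⟧ t

≋⇒∼ : ∀ {n} (α β : Formula n) → α ≋ β → α ∼ β
≋⇒∼ α β α≋β s with M-eval α s | M-eval β s
... | p , q | p′ , q′ = trans p (trans (cong isOne (α≋β (lookup s))) (sym p′))
                      , trans q (trans (cong isZero (α≋β (lookup s))) (sym q′))

∼⇒≋ : ∀ {n} (α β : Formula n) → α ∼ β → α ≋ β
∼⇒≋ {n} α β α∼β t = begin
  K⟦ α ⟧ t           ≡⟨ K⟦⟧-cong (lookup∘tabulate t) α ⟨
  K⟦ α ⟧ (lookup s)  ≡⟨ isOne-isZero-injective _ _ same-pos same-neg ⟩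
  K⟦ β ⟧ (lookup s)  ≡⟨ K⟦⟧-cong (lookup∘tabulate t) β ⟩
  K⟦ β ⟧ t           ∎
  where
    open ≡-Reasoning
    s : Vec K n
    s = tabulate t
    same-pos : isOne (K⟦ α ⟧ (lookup s)) ≡ isOne (K⟦ β ⟧ (lookup s))
    same-pos with M-eval α s | M-eval β s | α∼β s
    ... | p , _ | p′ , _ | e , _ = trans (sym p) (trans e p′)
    same-neg : isZero (K⟦ α ⟧ (lookup s)) ≡ isZero (K⟦ β ⟧ (lookup s))
    same-neg with M-eval α s | M-eval β s | α∼β s
    ... | _ , q | _ , q′ | _ , e = trans (sym q) (trans e q′)

-- F*_n/∼ satisfies every DMF-law because 𝕂 does, pointwise
lindenbaum-isDMF : ∀ n → IsDMFAlgebra (_∼_ {n}) _∧f_ _∨f_ ¬f 0f 1f nf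
lindenbaum-isDMF n = record
  { isDistributiveLattice = record
    { isLattice = record
      { isEquivalence = record
        { refl  = λ {x} → ≋⇒∼ x x λ t → refl
        ; sym   = λ {x} {y} p → ≋⇒∼ y x λ t → sym (∼⇒≋ x y p t)
        ; trans = λ {x} {y} {z} p q → ≋⇒∼ x z λ t → trans (∼⇒≋ x y p t) (∼⇒≋ y z q t)
        }
      ; ∨-comm  = λ x y → ≋⇒∼ (x ∨f y) (y ∨f x) λ t →
          𝕂≤.∨-comm (K⟦ x ⟧ t) (K⟦ y ⟧ t)
      ; ∨-assoc = λ x y z → ≋⇒∼ ((x ∨f y) ∨f z) (x ∨f (y ∨f z)) λ t →
          𝕂≤.∨-assoc (K⟦ x ⟧ t) (K⟦ y ⟧ t) (K⟦ z ⟧ t)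
      ; ∨-cong  = λ {x} {x′} {y} {y′} p q → ≋⇒∼ (x ∨f y) (x′ ∨f y′) λ t →
          cong₂ maxK (∼⇒≋ x x′ p t) (∼⇒≋ y y′ q t)
      ; ∧-comm  = λ x y → ≋⇒∼ (x ∧f y) (y ∧f x) λ t →
          𝕂≤.∧-comm (K⟦ x ⟧ t) (K⟦ y ⟧ t)
      ; ∧-assoc = λ x y z → ≋⇒∼ ((x ∧f y) ∧f z) (x ∧f (y ∧f z)) λ t →
          𝕂≤.∧-assoc (K⟦ x ⟧ t) (K⟦ y ⟧ t) (K⟦ z ⟧ t)
      ; ∧-cong  = λ {x} {x′} {y} {y′} p q → ≋⇒∼ (x ∧f y) (x′ ∧f y′) λ t →
          cong₂ minK (∼⇒≋ x x′ p t) (∼⇒≋ y y′ q t)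
      ; absorptive =
          (λ x y → ≋⇒∼ (x ∨f (x ∧f y)) x λ t → 𝕂≤.∨-absorbs-∧ (K⟦ x ⟧ t) (K⟦ y ⟧ t))
        , (λ x y → ≋⇒∼ (x ∧f (x ∨f y)) x λ t → 𝕂≤.∧-absorbs-∨ (K⟦ x ⟧ t) (K⟦ y ⟧ t))
      }
    ; ∨-distrib-∧ =
        (λ x y z → ≋⇒∼ (x ∨f (y ∧f z)) ((x ∨f y) ∧f (x ∨f z)) λ t →
          𝕂≤.∨-distribˡ-∧ (K⟦ x ⟧ t) (K⟦ y ⟧ t) (K⟦ z ⟧ t))
      , (λ x y z → ≋⇒∼ ((y ∧f z) ∨f x) ((y ∨f x) ∧f (z ∨f x)) λ t →
          𝕂≤.∨-distribʳ-∧ (K⟦ x ⟧ t) (K⟦ y ⟧ t) (K⟦ z ⟧ t))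
    ; ∧-distrib-∨ =
        (λ x y z → ≋⇒∼ (x ∧f (y ∨f z)) ((x ∧f y) ∨f (x ∧f z)) λ t →
          𝕂≤.∧-distribˡ-∨ (K⟦ x ⟧ t) (K⟦ y ⟧ t) (K⟦ z ⟧ t))
      , (λ x y z → ≋⇒∼ ((y ∨f z) ∧f x) ((y ∧f x) ∨f (z ∧f x)) λ t →
          𝕂≤.∧-distribʳ-∨ (K⟦ x ⟧ t) (K⟦ y ⟧ t) (K⟦ z ⟧ t))
    }
  ; ¬-cong       = λ {x} {y} p → ≋⇒∼ (¬f x) (¬f y) λ t → cong negK (∼⇒≋ x y p t)
  ; ∧-identity   = (λ x → ≋⇒∼ (1f ∧f x) x λ t → proj₁ 𝕂≤.∧-identity (K⟦ x ⟧ t))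
                 , (λ x → ≋⇒∼ (x ∧f 1f) x λ t → proj₂ 𝕂≤.∧-identity (K⟦ x ⟧ t))
  ; ∨-identity   = (λ x → ≋⇒∼ (0f ∨f x) x λ t → proj₁ 𝕂≤.∨-identity (K⟦ x ⟧ t))
                 , (λ x → ≋⇒∼ (x ∨f 0f) x λ t → proj₂ 𝕂≤.∨-identity (K⟦ x ⟧ t))
  ; ¬-involutive = λ x → ≋⇒∼ (¬f (¬f x)) x λ t → 𝕂≤.¬-involutive (K⟦ x ⟧ t)
  ; deMorgan     = λ x y → ≋⇒∼ (¬f (x ∧f y)) (¬f x ∨f ¬f y) λ t →
                     𝕂≤.deMorgan (K⟦ x ⟧ t) (K⟦ y ⟧ t)
  ; kleene       = λ x y → ≋⇒∼ ((x ∧f ¬f x) ∧f (y ∨f ¬f y)) (x ∧f ¬f x) λ t →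
                     𝕂≤.kleene (K⟦ x ⟧ t) (K⟦ y ⟧ t)
  ; ¬n≈n         = ≋⇒∼ (¬f nf) nf λ t → refl
  }

indicator : ∀ {n} → Fin n → Fin n → K
indicator i j = if isYes (j ≟ i) then k1 else k0

isOne-indicator : ∀ {n} (i j : Fin n) → isOne (indicator i j) ≡ isYes (j ≟ i)
isOne-indicator i j with isYes (j ≟ i)
... | true  = refl
... | false = refl

-- distinct variables differ at the indicator point of one of them
generators-distinct : ∀ {n} (i j : Fin n) → var i ∼ var j → i ≡ j
generators-distinct i j i∼j = sym (toWitness j≟i-holds)
  where
    same-answer : isYes (i ≟ i) ≡ isYes (j ≟ i)
    same-answer = begin
      isYes (i ≟ i)              ≡⟨ isOne-indicator i i ⟨
      isOne (indicator i i)      ≡⟨ cong isOne (∼⇒≋ (var i) (var j) i∼j (indicator i)) ⟩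
      isOne (indicator i j)      ≡⟨ isOne-indicator i j ⟩
      isYes (j ≟ i)              ∎
      where open ≡-Reasoning
    j≟i-holds : True (j ≟ i)
    j≟i-holds = subst T same-answer (fromWitness {a? = i ≟ i} refl)

-- The point of a clause: p_j gets 1 if only p_j occurs, 0 if only ¬p_j
-- occurs, and n otherwise

_∈ᶜ?_ : ∀ {n} (a : Atom n) (C : Clause n) → Dec (a ∈ C)
a ∈ᶜ? C = DecMembership._∈?_ _≟ᵃ_ a C

fromOccurrences : Bool → Bool → K
fromOccurrences true  false = k1
fromOccurrences false true  = k0
fromOccurrences _     _     = kn

point : ∀ {n} → Clause n → Fin n → K
point C j = fromOccurrences (isYes (lit true j ∈ᶜ? C)) (isYes (lit false j ∈ᶜ? C))

literal-at-point : ∀ {n} b (j : Fin n) C → K⟦ lit b j ⟧ᵃ (point C) ≡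
                   fromOccurrences (isYes (lit b j ∈ᶜ? C)) (isYes (lit (not b) j ∈ᶜ? C))
literal-at-point true  j C = refl
literal-at-point false j C = negK-swap (isYes (lit true j ∈ᶜ? C)) (isYes (lit false j ∈ᶜ? C))
  where
    negK-swap : ∀ u v → negK (fromOccurrences u v) ≡ fromOccurrences v u
    negK-swap true  true  = refl
    negK-swap true  false = refl
    negK-swap false true  = refl
    negK-swap false false = refl

-- how the value relates to the occurrences (a? : literal, b? : complement)
module _ {A B : Set} where
  occurring-nonfalse : (a? : Dec A) (b? : Dec B) → A → kn ≤K fromOccurrences (isYes a?) (isYes b?)
  occurring-nonfalse (yes _)  (yes _) _ = refl
  occurring-nonfalse (yes _)  (no _)  _ = refl
  occurring-nonfalse (no a∉) _       a = ⊥-elim (a∉ a)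

  occurring-true : (a? : Dec A) (b? : Dec B) → A → ¬ B → k1 ≤K fromOccurrences (isYes a?) (isYes b?)
  occurring-true (yes _)  (no _)  _ _  = refl
  occurring-true (yes _)  (yes b) _ b∉ = ⊥-elim (b∉ b)
  occurring-true (no a∉) _       a _  = ⊥-elim (a∉ a)

  true-occurring : (a? : Dec A) (b? : Dec B) → k1 ≤K fromOccurrences (isYes a?) (isYes b?) → A
  true-occurring (yes a) _       _  = a
  true-occurring (no _)  (yes _) ()
  true-occurring (no _)  (no _)  ()

  nonfalse-occurring : (a? : Dec A) (b? : Dec B) → A ⊎ B →
                       kn ≤K fromOccurrences (isYes a?) (isYes b?) → A
  nonfalse-occurring (yes a)  _        _        _  = a
  nonfalse-occurring (no _)   (yes _)  _        ()
  nonfalse-occurring (no a∉) (no _)   (inj₁ a) _  = ⊥-elim (a∉ a)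
  nonfalse-occurring (no _)   (no b∉) (inj₂ b) _  = ⊥-elim (b∉ b)

point-nonfalse : ∀ {n} (C : Clause n) → kn ≤K K⟦ C ⟧ᶜ (point C)
point-nonfalse C = Semantics.clause-greatest 𝕂 (point C) C atom-nonfalse
  where
    atom-nonfalse : ∀ {a} → a ∈ C → kn ≤K K⟦ a ⟧ᵃ (point C)
    atom-nonfalse {nconst}  _   = refl
    atom-nonfalse {lit b j} a∈C =
      subst (kn ≤K_) (sym (literal-at-point b j C))
            (occurring-nonfalse (lit b j ∈ᶜ? C) (lit (not b) j ∈ᶜ? C) a∈C)

Complementary : ∀ {n} → Clause n → Set
Complementary C = ∃ λ j → lit true j ∈ C × lit false j ∈ C

complementary? : ∀ {n} (C : Clause n) → Dec (Complementary C)
complementary? C = any? λ j → (lit true j ∈ᶜ? C) ×-dec (lit false j ∈ᶜ? C)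

point-true : ∀ {n} (C : Clause n) → nconst ∉ C → ¬ Complementary C → k1 ≤K K⟦ C ⟧ᶜ (point C)
point-true C n∉C consistent = Semantics.clause-greatest 𝕂 (point C) C atom-true
  where
    literal-true : ∀ b j → lit b j ∈ C → lit (not b) j ∉ C → k1 ≤K K⟦ lit b j ⟧ᵃ (point C)
    literal-true b j l∈C l̄∉C = subst (k1 ≤K_) (sym (literal-at-point b j C))
                                     (occurring-true (lit b j ∈ᶜ? C) (lit (not b) j ∈ᶜ? C) l∈C l̄∉C)
    atom-true : ∀ {a} → a ∈ C → k1 ≤K K⟦ a ⟧ᵃ (point C)
    atom-true {nconst}      n∈C  = ⊥-elim (n∉C n∈C)
    atom-true {lit true j}  p∈C  = literal-true true j p∈C (λ ¬p∈C → consistent (j , p∈C , ¬p∈C))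
    atom-true {lit false j} ¬p∈C = literal-true false j ¬p∈C (λ p∈C → consistent (j , p∈C , ¬p∈C))

true-at-point : ∀ {n} b (j : Fin n) C → k1 ≤K K⟦ lit b j ⟧ᵃ (point C) → lit b j ∈ C
true-at-point b j C h =
  true-occurring (lit b j ∈ᶜ? C) (lit (not b) j ∈ᶜ? C) (subst (k1 ≤K_) (literal-at-point b j C) h)

Covers : ∀ {n} → Clause n → Fin n → Set
Covers C j = lit true j ∈ C ⊎ lit false j ∈ C

covers-new : ∀ {n} b (v : Fin n) C → Covers (lit b v ∷ C) v
covers-new true  v C = inj₁ (here refl)
covers-new false v C = inj₂ (here refl)

covers-there : ∀ {n} {a : Atom n} {C j} → Covers C j → Covers (a ∷ C) j
covers-there = ⊎-map there there

nonfalse-at-point : ∀ {n} b (j : Fin n) C → Covers C j → kn ≤K K⟦ lit b j ⟧ᵃ (point C) → lit b j ∈ C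
nonfalse-at-point b j C covered h =
  nonfalse-occurring (lit b j ∈ᶜ? C) (lit (not b) j ∈ᶜ? C) (signed b covered)
                     (subst (kn ≤K_) (literal-at-point b j C) h)
  where
    signed : ∀ b → Covers C j → lit b j ∈ C ⊎ lit (not b) j ∈ C
    signed true  = id
    signed false = swap

-- Completeness: three-valued consequence implies the order in 𝒜

nnf-≋ : ∀ {n} (α β : Formula n) → α ≋ β → ∀ t → K⟦ nnf true α ⟧ᴸ t ≡ K⟦ nnf true β ⟧ᴸ t
nnf-≋ α β α≋β t = begin
  K⟦ nnf true α ⟧ᴸ t  ≡⟨ Semantics.nnf-correct 𝕂 t true α ⟩
  K⟦ α ⟧ t            ≡⟨ α≋β t ⟩
  K⟦ β ⟧ t            ≡⟨ Semantics.nnf-correct 𝕂 t true β ⟨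
  K⟦ nnf true β ⟧ᴸ t  ∎
  where open ≡-Reasoning

_⊨_ : ∀ {n} → Clause n → LTerm n → Set
C ⊨ Q = ∀ t → K⟦ C ⟧ᶜ t ≤K K⟦ Q ⟧ᴸ t

⊨-extend : ∀ {n} (a : Atom n) C Q → C ⊨ Q → (a ∷ C) ⊨ Q
⊨-extend a C Q C⊨Q t = ≤K-trans (𝕂≤.x∧y≤y (K⟦ a ⟧ᵃ t) (K⟦ C ⟧ᶜ t)) (C⊨Q t)

module Completeness {c ℓ} (𝒜 : DMFAlgebra c ℓ) {n : ℕ} (g : Fin n → DMFAlgebra.Carrier 𝒜) where
  open DMFProperties 𝒜
  open Semantics 𝒜 g
  open SetoidReasoning setoid

  module _ {x : Carrier} (t : Fin n → K) {v : K} (v≢0 : v ≢ k0)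
           (atom-below : ∀ a → v ≤K K⟦ a ⟧ᵃ t → x ≤ ⟦ a ⟧ᵃ) where
    atoms-suffice : ∀ P → v ≤K K⟦ P ⟧ᴸ t → x ≤ ⟦ P ⟧ᴸ
    atoms-suffice (atom a) v≤ = atom-below a v≤
    atoms-suffice (P ∧ᴸ Q) v≤ =
      ∧-greatest (atoms-suffice P (≤K-trans v≤ (𝕂≤.x∧y≤x (K⟦ P ⟧ᴸ t) (K⟦ Q ⟧ᴸ t))))
                 (atoms-suffice Q (≤K-trans v≤ (𝕂≤.x∧y≤y (K⟦ P ⟧ᴸ t) (K⟦ Q ⟧ᴸ t))))
    atoms-suffice (P ∨ᴸ Q) v≤ with ≤K-max-split v (K⟦ P ⟧ᴸ t) (K⟦ Q ⟧ᴸ t) v≤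
    ... | inj₁ v≤P = ≤-trans (atoms-suffice P v≤P) (x≤x∨y _ _)
    ... | inj₂ v≤Q = ≤-trans (atoms-suffice Q v≤Q) (y≤x∨y _ _)
    atoms-suffice ⊤ᴸ       _  = ≤-1 x
    atoms-suffice ⊥ᴸ       v≤ = ⊥-elim (v≢0 (≤K-bottom v v≤))

  -- a consistent clause is true at its own point, so Q is true there as well
  consistent-clause : ∀ C Q → nconst ∉ C → ¬ Complementary C → C ⊨ Q → ⟦ C ⟧ᶜ ≤ ⟦ Q ⟧ᴸ
  consistent-clause C Q n∉C consistent C⊨Q =
    atoms-suffice (point C) (λ ()) atom-below Q
                  (≤K-trans (point-true C n∉C consistent) (C⊨Q (point C)))
    where
      atom-below : ∀ a → k1 ≤K K⟦ a ⟧ᵃ (point C) → ⟦ C ⟧ᶜ ≤ ⟦ a ⟧ᵃ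
      atom-below (lit b j) h = clause-∈ (true-at-point b j C h)
      atom-below nconst    ()

  -- a covering clause below n is not false at its point, so neither is Q
  covering-clause : ∀ C Q → ⟦ C ⟧ᶜ ≤ nₐ → (∀ j → Covers C j) → C ⊨ Q → ⟦ C ⟧ᶜ ≤ ⟦ Q ⟧ᴸ
  covering-clause C Q C≤n covered C⊨Q =
    atoms-suffice (point C) (λ ()) atom-below Q
                  (≤K-trans (point-nonfalse C) (C⊨Q (point C)))
    where
      atom-below : ∀ a → kn ≤K K⟦ a ⟧ᵃ (point C) → ⟦ C ⟧ᶜ ≤ ⟦ a ⟧ᵃ
      atom-below (lit b j) h = clause-∈ (nonfalse-at-point b j C (covered j) h)
      atom-below nconst    _ = C≤n

  -- below n, the Kleene law n ≤ x ∨ ¬x splits a clause on the variable v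
  split-on : ∀ C v → ⟦ C ⟧ᶜ ≤ nₐ → ⟦ C ⟧ᶜ ≤ ⟦ lit true v ∷ C ⟧ᶜ ∨ₐ ⟦ lit false v ∷ C ⟧ᶜ
  split-on C v C≤n =
    ≤-trans (∧-greatest (≤-trans C≤n (n≤x∨¬x (g v))) ≤-refl)
            (≤-reflexive (∧-distribʳ-∨ ⟦ C ⟧ᶜ (g v) (¬ₐ (g v))))

  split-variables : ∀ (vs : List (Fin n)) C Q → ⟦ C ⟧ᶜ ≤ nₐ → (∀ j → j ∈ vs ⊎ Covers C j) →
                    C ⊨ Q → ⟦ C ⟧ᶜ ≤ ⟦ Q ⟧ᴸ
  split-variables []       C Q C≤n covered C⊨Q =
    covering-clause C Q C≤n (λ j → fromInj₂ (λ ()) (covered j)) C⊨Q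
  split-variables (v ∷ vs) C Q C≤n covered C⊨Q =
    ≤-trans (split-on C v C≤n) (∨-least (branch true) (branch false))
    where
      branch : ∀ b → ⟦ lit b v ∷ C ⟧ᶜ ≤ ⟦ Q ⟧ᴸ
      branch b = split-variables vs (lit b v ∷ C) Q (≤-trans (x∧y≤y _ _) C≤n) covered′
                                 (⊨-extend (lit b v) C Q C⊨Q)
        where
          covered′ : ∀ j → j ∈ vs ⊎ Covers (lit b v ∷ C) j
          covered′ j with covered j
          ... | inj₁ (here refl)  = inj₂ (covers-new b v C)
          ... | inj₁ (there j∈vs) = inj₁ j∈vs
          ... | inj₂ C-covers-j   = inj₂ (covers-there C-covers-j)

  clause-below-n : ∀ C Q → ⟦ C ⟧ᶜ ≤ nₐ → C ⊨ Q → ⟦ C ⟧ᶜ ≤ ⟦ Q ⟧ᴸ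
  clause-below-n C Q C≤n = split-variables (allFin n) C Q C≤n (λ j → inj₁ (∈-allFin j))

  -- a clause is either below n (it contains n or some p_j, ¬p_j) or consistent
  clause-complete : ∀ C Q → C ⊨ Q → ⟦ C ⟧ᶜ ≤ ⟦ Q ⟧ᴸ
  clause-complete C Q C⊨Q with nconst ∈ᶜ? C | complementary? C
  ... | yes n∈C | _                    = clause-below-n C Q (clause-∈ n∈C) C⊨Q
  ... | no _    | yes (j , p∈C , ¬p∈C) = clause-below-n C Q C≤n C⊨Q
    where
      C≤n : ⟦ C ⟧ᶜ ≤ nₐ
      C≤n = ≤-trans (∧-greatest (clause-∈ p∈C) (clause-∈ ¬p∈C)) (x∧¬x≤n (g j))
  ... | no n∉C  | no consistent        = consistent-clause C Q n∉C consistent C⊨Q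

  complete : ∀ P Q → (∀ t → K⟦ P ⟧ᴸ t ≤K K⟦ Q ⟧ᴸ t) → ⟦ P ⟧ᴸ ≤ ⟦ Q ⟧ᴸ
  complete P Q P⊨Q = ≤-trans (≤-reflexive (dnf-correct P)) (dnf-least (dnf P) clause-below)
    where
      clause-below : ∀ {C} → C ∈ dnf P → ⟦ C ⟧ᶜ ≤ ⟦ Q ⟧ᴸ
      clause-below {C} C∈ =
        clause-complete C Q λ t → ≤K-trans (Semantics.dnf-clause-below 𝕂 t P C∈) (P⊨Q t)

  well-defined : ∀ α β → α ∼ β → ⟦ α ⟧ ≈ ⟦ β ⟧
  well-defined α β α∼β = begin
    ⟦ α ⟧            ≈⟨ nnf-correct true α ⟨
    ⟦ nnf true α ⟧ᴸ  ≈⟨ ≤-antisym (complete (nnf true α) (nnf true β) (nnf-below α β α≋β))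
                                  (complete (nnf true β) (nnf true α) (nnf-below β α β≋α)) ⟩
    ⟦ nnf true β ⟧ᴸ  ≈⟨ nnf-correct true β ⟩
    ⟦ β ⟧            ∎
    where
      α≋β : α ≋ β
      α≋β = ∼⇒≋ α β α∼β
      β≋α : β ≋ α
      β≋α t = sym (α≋β t)
      nnf-below : ∀ α β → α ≋ β → ∀ t → K⟦ nnf true α ⟧ᴸ t ≤K K⟦ nnf true β ⟧ᴸ t
      nnf-below α β α≋β t = ≤K-reflexive (nnf-≋ α β α≋β t)

  evaluation-isHom : IsDMFHom 𝒜 ⟦_⟧
  evaluation-isHom = record
    { well-defined = λ {α} {β} → well-defined α β
    ; hom-∧ = λ _ _ → ≈-refl
    ; hom-∨ = λ _ _ → ≈-refl
    ; hom-¬ = λ _ → ≈-refl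
    ; hom-0 = ≈-refl
    ; hom-1 = ≈-refl
    ; hom-n = ≈-refl
    }

mainTheorem16 : ∀ {c ℓ : Level} (n : ℕ) →
    IsDMFAlgebra (_∼_ {n}) _∧f_ _∨f_ ¬f 0f 1f nf
    × (∀ (i j : Fin n) → var i ∼ var j → i ≡ j)
    × ((𝒜 : DMFAlgebra c ℓ) (g : Fin n → DMFAlgebra.Carrier 𝒜) →
        Σ (Formula n → DMFAlgebra.Carrier 𝒜) (λ h →
          IsDMFHom 𝒜 h
          × (∀ i → DMFAlgebra._≈_ 𝒜 (h (var i)) (g i))
          × (∀ h′ → IsDMFHom 𝒜 h′ → (∀ i → DMFAlgebra._≈_ 𝒜 (h′ (var i)) (g i)) →
               ∀ α → DMFAlgebra._≈_ 𝒜 (h′ α) (h α))))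
mainTheorem16 n = lindenbaum-isDMF n , generators-distinct , λ 𝒜 g →
  let open Semantics 𝒜 g
      open Completeness 𝒜 g
  in ⟦_⟧ , evaluation-isHom , (λ i → DMFProperties.≈-refl 𝒜) , extension-unique
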